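{- Let $P$ be a partially observable plant, $\beta$ a propositional formula over its state variables, and $D_\varphi$ the belief-automaton diagnoser for $\varphi=\mathrm{ExactDel}(A_\varphi,\beta,0)$. For every reachable state $b\times s$ of $D_\varphi\otimes P$, for every finite trace prefix $\sigma$ of $D_\varphi\otimes P$ reaching $b\times s$, and for every state $s'\in b$, there exists a finite trace prefix $\sigma'$ of $D_\varphi\otimes P$ reaching $b\times s'$ with $\mathit{obs}(\sigma)=\mathit{obs}(\sigma')$.
   Context: A plant $P=\langle V^P,E^P,I^P,\mathcal T^P,E^P_o\rangle$ is a labeled transition system: finite set $V^P$ of state variables over a finite domain (finite state set $S$ of assignments to $V^P$), events $E^P$, initial formula $I^P$, transition formulas $\mathcal T^P(e)$ over $V^P\cup V^{P\prime}$, observable events $E^P_o\subseteq E^P$. A trace is an infinite sequence $s_0,e_0,s_1,e_1,\dots$ with $s_0$ initial and $\langle s_k,s_{k+1}\rangle\models\mathcal T(e_k)$; a finite trace prefix $s_0,e_0,\dots,s_k$ reaches $s_k$. For a prefix $\sigma^k$, $\mathit{obs}(\sigma^k)$ is the subsequence of events among $e_0,\dots,e_{k-1}$ lying in $E^P_o$. Belief automaton: for $b\subseteq S$, $b^*$ is the least superset of $b$ closed under transitions $\langle s',s\rangle\models\mathcal T^P(e)$ with $e\in E^P\setminus E^P_o$. $b_0=\{s\mid s\models I^P\}$; $R(b,e)=\{s'\mid\exists s\in b^*.\ \langle s,s'\rangle\models\mathcal T^P(e)\}$ for $e\in E^P_o$. $D_\varphi$ is the LTS with events $E^P_o$, states the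 subsets $b\subseteq S$, initial state $b_0$, transitions $b\xrightarrow{e}R(b,e)$, and alarm variable $A_\varphi$ true in $b$ iff all $s\in b$ satisfy $\beta$. $D_\varphi\otimes P$ is the asynchronous product: states $b\times s$, initial states $b_0\times s_0$ with $s_0\models I^P$; on $e\in E^P\setminus E^P_o$ the plant moves and $b$ is unchanged; on $e\in E^P_o$, $b\times s\to R(b,e)\times s'$ where $\langle s,s'\rangle\models\mathcal T^P(e)$. Its observable events are $E^P_o$. -}

module Defs where

open import Data.Nat using (ℕ)
open import Data.Fin using (Fin)
open import Data.Bool using (Bool; true; false)
open import Data.List using (List; []; _∷_; _∷ʳ_)
open import Data.Product using (Σ; _×_; _,_)
open import Relation.Binary.PropositionalEquality using (_≡_)

-- A plant: finite state set S = Fin nS (assignments to the finite-domain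
-- state variables), finite event set Fin nE, initial formula I^P and
-- transition formulas T^P(e) given by their denotations (predicates /
-- relations on states), and the observable events E_o given by the
-- characteristic function isObs.
record Plant : Set₁ where
  field
    nS     : ℕ
    nE     : ℕ
    Init   : Fin nS → Set
    Trans  : Fin nE → Fin nS → Fin nS → Set
    isObs  : Fin nE → Bool

module Diagnoser (P : Plant) where
  open Plant P

  State : Set
  State = Fin nS

  Event : Set
  Event = Fin nE

  Belief : Set₁
  Belief = State → Set

  _∈ᵇ_ : State → Belief → Set
  s ∈ᵇ b = b s

  data Star (b : Belief) : State → Set where
    base : ∀ {s} → b s → Star b s
    ext  : ∀ {s s'} (e : Event) → isObs e ≡ false →
           Star b s → Trans e s s' → Star b s'

  b₀ : Belief
  b₀ s = Init s

  R : Belief → Event → Belief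
  R b e s' = Σ State (λ s → Star b s × Trans e s s')

  Alarm : (β : State → Set) → Belief → Set
  Alarm β b = ∀ s → b s → β s

  data ProdStep : Belief → State → Event → Belief → State → Set₁ where
    unobsStep : ∀ {b s s'} (e : Event) → isObs e ≡ false →
                Trans e s s' → ProdStep b s e b s'
    obsStep   : ∀ {b s s'} (e : Event) → isObs e ≡ true →
                Trans e s s' → ProdStep b s e (R b e) s'

  data Prefix : Belief → State → Set₁ where
    start : ∀ {s} → Init s → Prefix b₀ s
    step  : ∀ {b s b' s'} → Prefix b s → (e : Event) →
            ProdStep b s e b' s' → Prefix b' s'

  obsEvents : ∀ {b s} → Prefix b s → List Event
  obsEvents (start _) = []
  obsEvents (step σ e _) with isObs e
  ... | true  = obsEvents σ ∷ʳ e
  ... | false = obsEvents σ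

-- The initial belief is realised by the empty prefix, and unobservable steps
-- change neither the belief nor the observation. After an observable step e, a state s' ∈ R(b, e)
-- has an e-predecessor s₀ ∈ b*; by induction every state of b is reached with the observations
-- of σ, and unobservable plant moves carry such a prefix on to s₀ without changing either the
-- belief component or the observation, so appending the step e yields σ'.
module Submission where

open import Defs
open import Data.Bool using (true; false)
open import Data.List using (List; _∷ʳ_)
open import Data.Product using (Σ; _,_)
open import Relation.Binary.PropositionalEquality using (_≡_; refl; sym; trans; cong; module ≡-Reasoning)

module _ (P : Plant) where
  open Plant P
  open Diagnoser P

  PrefixWithObs : Belief → State → List Event → Set₁
  PrefixWithObs b s o = Σ (Prefix b s) (λ σ → o ≡ obsEvents σ)

  obsEvents-unobsStep : ∀ {b s b' s'} (σ : Prefix b s) e (st : ProdStep b s e b' s') →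
    isObs e ≡ false → obsEvents (step σ e st) ≡ obsEvents σ
  obsEvents-unobsStep σ e st unobs with isObs e
  obsEvents-unobsStep σ e st refl | false = refl

  obsEvents-obsStep : ∀ {b s b' s'} (σ : Prefix b s) e (st : ProdStep b s e b' s') →
    isObs e ≡ true → obsEvents (step σ e st) ≡ obsEvents σ ∷ʳ e
  obsEvents-obsStep σ e st obs with isObs e
  obsEvents-obsStep σ e st refl | true = refl

  Star-prefixWithObs : ∀ {b o} → (∀ s → b s → PrefixWithObs b s o) →
    ∀ {s} → Star b s → PrefixWithObs b s o
  Star-prefixWithObs reach (base s∈b) = reach _ s∈b
  Star-prefixWithObs reach (ext e unobs s∈b* t) with Star-prefixWithObs reach s∈b*
  ... | σ , o≡ = step σ e st , trans o≡ (sym (obsEvents-unobsStep σ e st unobs))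
    where st = unobsStep e unobs t

  belief-prefixWithObs : ∀ {b s} (σ : Prefix b s) →
    ∀ s' → b s' → PrefixWithObs b s' (obsEvents σ)
  belief-prefixWithObs (start _) s' init = start init , refl
  belief-prefixWithObs (step σ e st@(unobsStep .e unobs _)) s' s'∈b
    with belief-prefixWithObs σ s' s'∈b
  ... | σ' , o≡ = σ' , trans (obsEvents-unobsStep σ e st unobs) o≡
  belief-prefixWithObs (step σ e st@(obsStep .e obs _)) s' (s₀ , s₀∈b* , t)
    with Star-prefixWithObs (belief-prefixWithObs σ) s₀∈b*
  ... | σ' , o≡ = step σ' e st' , (begin
      obsEvents (step σ e st)    ≡⟨ obsEvents-obsStep σ e st obs ⟩
      obsEvents σ ∷ʳ e           ≡⟨ cong (_∷ʳ e) o≡ ⟩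
      obsEvents σ' ∷ʳ e          ≡⟨ sym (obsEvents-obsStep σ' e st' obs) ⟩
      obsEvents (step σ' e st')  ∎)
    where
    open ≡-Reasoning
    st' = obsStep e obs t

-- β only determines the alarm of D_φ, which does not influence the product's transitions.
lemma6p2 : (P : Plant) → (β : Diagnoser.State P → Set) →
    ∀ {b s} → (σ : Diagnoser.Prefix P b s) →
    ∀ s' → Diagnoser._∈ᵇ_ P s' b →
    Σ (Diagnoser.Prefix P b s') (λ σ' → Diagnoser.obsEvents P σ ≡ Diagnoser.obsEvents P σ')
lemma6p2 P β σ = belief-prefixWithObs P σ
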